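{- (a) For every $\alpha\in\vartheta(\varepsilon_{\Omega+1})$, $\overline E(f(\alpha))=\{f(\gamma)\mid\gamma\in E(\alpha)\}$. (b) For all $t\in T_2$ and $s\in\overline E(t)$, we have $s\trianglelefteq t$. (c) For every $\sigma\in\vartheta(\varepsilon_{\Omega+1})$ and $t\in T_2$: if $f(\vartheta\sigma)\trianglelefteq t$, then $f(\vartheta\sigma)\trianglelefteq t'$ for some $t'\in\overline E(t)$.
   Context: Terms $\vartheta(\varepsilon_{\Omega+1})$, relation $\prec$ and finite sets $E(\alpha)$ are defined by simultaneous recursion on term length: Terms: $\Omega$; $\vartheta\alpha$ for every term $\alpha$; $\langle\alpha_0,\dots,\alpha_{n-1}\rangle$ ($n\ge0$) for terms $\alpha_i$, provided that if $n>1$ then $\alpha_{n-1}\preceq\dots\preceq\alpha_0$ ($\preceq$ meaning $\prec$ or syntactic equality), and if $n=1$ then $\alpha_0$ is not of the form $\Omega$ or $\vartheta\beta$. $E(\Omega)=\emptyset$, $E(\vartheta\alpha)=\{\vartheta\alpha\}$, $E(\langle\alpha_0,\dots,\alpha_{n-1}\rangle)=\bigcup_{i<n}E(\alpha_i)$. $\alpha\prec\beta$ holds iff: (1) $\alpha=\Omega$ and $\beta=\langle\beta_0,\dots,\beta_{n-1}\rangle$ with $n>0$, $\Omega\preceq\beta_0$; or (2) $\alpha=\vartheta\alpha'$ and one of: $\beta=\Omega$; $\beta=\langle\beta_0,\dots,\beta_{n-1}\rangle$ with $n>0$, $\alpha\preceq\beta_0$; $\beta=\vartheta\beta'$ with $\alpha'\prec\beta'$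 and $\gamma\prec\beta$ for all $\gamma\in E(\alpha')$; $\beta=\vartheta\beta'$ with $\alpha\preceq\gamma$ for some $\gamma\in E(\beta')$; or (3) $\alpha=\langle\alpha_0,\dots,\alpha_{m-1}\rangle$ and one of: $\beta$ is $\Omega$ or some $\vartheta\beta'$, and $m=0$ or $\alpha_0\prec\beta$; $\beta=\langle\beta_0,\dots,\beta_{n-1}\rangle$ and for some $j\le\min(m,n)$, $\alpha_i=\beta_i$ for all $i<j$ and either $j=m<n$ or ($j<\min(m,n)$ and $\alpha_j\prec\beta_j$). $T_2$ is generated by: for a finite multiset $\sigma=[t_0,\dots,t_{k-1}]$ ($k\ge0$) of already constructed elements and $n\in\{0,1\}$, $n\star\sigma\in T_2$; $r(n\star\sigma)=n$. For a relation $\le$, $[x_0,\dots,x_{k-1}]\le^M[y_0,\dots,y_{m-1}]$ iff there is an injection $g$ with $x_i\le y_{g(i)}$ for all $i<k$. Recursively, $s\trianglelefteq t$ iff $s=m\star\sigma$, $t=n\star\tau$ with $m=n$ and $\sigma\trianglelefteq^M\tau$, or $t=n\star[t_0,\dots,t_{k-1}]$ with $r(s)\le n$ and $s\trianglelefteq t_i$ for some $i<k$. $f:\vartheta(\varepsilon_{\Omega+1})\to T_2$: $f(\Omega)=1\star[]$, $f(\vartheta\alpha)=0\star[1\star[f(\alpha)]]$, $f(\langle\alpha_0,\dots,\alpha_{n-1}\rangle)=i\star[f(\alpha_0),\dots,f(\alpha_{n-1})]$ with $i=0$ if $n=0$ or $\alpha_0\prec\Omega$, and $i=1$ otherwise.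 $\overline E(t)\subseteq T_2$ is defined recursively: $\overline E(t)=\{t\}$ if $t=0\star[i_0\star\tau_0,\dots,i_{n-1}\star\tau_{n-1}]$ with $i_j=1$ for some $j<n$; otherwise, for $t=i\star[t_0,\dots,t_{n-1}]$, $\overline E(t)=\bigcup_{j<n}\overline E(t_j)$. -}

module Defs where

open import Data.Bool using (Bool; true; false; if_then_else_; _∨_)
open import Data.Fin using (Fin; zero; suc)
import Data.Fin as F
open import Data.List using (List; []; _∷_; _++_; length; lookup)
open import Data.List.Relation.Unary.All using (All)
open import Data.List.Relation.Unary.Any using (Any)
open import Data.List.Relation.Binary.Pointwise using (Pointwise)
open import Data.List.Relation.Binary.Permutation.Propositional using (_↭_)
open import Data.Product using (Σ; _×_; _,_)
open import Data.Sum using (_⊎_; inj₁; inj₂)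
open import Data.Empty using (⊥)
open import Function.Definitions using (Injective)
open import Relation.Nullary using (Dec; yes; no; does)
open import Relation.Binary.PropositionalEquality using (_≡_; refl)

data Tm : Set where
  Ω   : Tm
  ϑ   : Tm → Tm
  ⟨_⟩ : List Tm → Tm

mutual
  E : Tm → List Tm
  E Ω        = []
  E (ϑ a)    = ϑ a ∷ []
  E ⟨ as ⟩   = Es as

  Es : List Tm → List Tm
  Es []       = []
  Es (a ∷ as) = E a ++ Es as

mutual
  _≼_ : Tm → Tm → Set
  a ≼ b = a ≺ b ⊎ a ≡ b

  data _≺_ : Tm → Tm → Set where
    Ω≺⟨⟩   : ∀ {b bs} → Ω ≼ b → Ω ≺ ⟨ b ∷ bs ⟩
    ϑ≺Ω    : ∀ {a} → ϑ a ≺ Ω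
    ϑ≺⟨⟩   : ∀ {a b bs} → ϑ a ≼ b → ϑ a ≺ ⟨ b ∷ bs ⟩
    ϑ≺ϑ₁   : ∀ {a b} → a ≺ b → All (_≺ ϑ b) (E a) → ϑ a ≺ ϑ b
    ϑ≺ϑ₂   : ∀ {a b} → Any (ϑ a ≼_) (E b) → ϑ a ≺ ϑ b
    []≺Ω   : ⟨ [] ⟩ ≺ Ω
    []≺ϑ   : ∀ {b} → ⟨ [] ⟩ ≺ ϑ b
    ∷≺Ω    : ∀ {a as} → a ≺ Ω → ⟨ a ∷ as ⟩ ≺ Ω
    ∷≺ϑ    : ∀ {a as b} → a ≺ ϑ b → ⟨ a ∷ as ⟩ ≺ ϑ b
    ⟨⟩≺⟨⟩  : ∀ {as bs} → Lex as bs → ⟨ as ⟩ ≺ ⟨ bs ⟩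

  data Lex : List Tm → List Tm → Set where
    lex-[]    : ∀ {b bs} → Lex [] (b ∷ bs)
    lex-here  : ∀ {a as b bs} → a ≺ b → Lex (a ∷ as) (b ∷ bs)
    lex-there : ∀ {a as bs} → Lex as bs → Lex (a ∷ as) (a ∷ bs)

data Descending : List Tm → Set where
  d[]  : Descending []
  d[a] : ∀ {a} → Descending (a ∷ [])
  d∷   : ∀ {a b as} → b ≼ a → Descending (b ∷ as) → Descending (a ∷ b ∷ as)

data NotPrincipal : Tm → Set where
  np : ∀ {as} → NotPrincipal ⟨ as ⟩

data SingletonOK : List Tm → Set where
  s[]  : SingletonOK []
  s[a] : ∀ {a} → NotPrincipal a → SingletonOK (a ∷ [])
  s≥2  : ∀ {a b as} → SingletonOK (a ∷ b ∷ as)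

data IsTerm : Tm → Set where
  tΩ : IsTerm Ω
  tϑ : ∀ {a} → IsTerm a → IsTerm (ϑ a)
  t⟨⟩ : ∀ {as} → All IsTerm as → Descending as → SingletonOK as → IsTerm ⟨ as ⟩

-- T₂: labelled rose trees, n ⋆ σ with n ∈ {0,1}; the multiset σ is
-- represented by a list, and identity of T₂-elements is the equivalence ≈T
-- (lists equal up to permutation, recursively).

data T2 : Set where
  _⋆_ : Fin 2 → List T2 → T2

r : T2 → Fin 2
r (n ⋆ _) = n

data _≈T_ : T2 → T2 → Set where
  ≈⋆ : ∀ {n σ ρ τ} → σ ↭ ρ → Pointwise _≈T_ ρ τ → (n ⋆ σ) ≈T (n ⋆ τ)

data _⊴_ : T2 → T2 → Set where
  ⊴-M   : ∀ {n σ τ} (g : Fin (length σ) → Fin (length τ)) →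
          Injective _≡_ _≡_ g →
          (∀ i → lookup σ i ⊴ lookup τ (g i)) →
          (n ⋆ σ) ⊴ (n ⋆ τ)
  ⊴-sub : ∀ {s n ts} → r s F.≤ n → Any (s ⊴_) ts → s ⊴ (n ⋆ ts)

≺Ω? : (a : Tm) → Dec (a ≺ Ω)
≺Ω? Ω = no (λ ())
≺Ω? (ϑ a) = yes ϑ≺Ω
≺Ω? ⟨ [] ⟩ = yes []≺Ω
≺Ω? ⟨ a ∷ as ⟩ with ≺Ω? a
... | yes p = yes (∷≺Ω p)
... | no ¬p = no (λ { (∷≺Ω p) → ¬p p })

mutual
  f : Tm → T2
  f Ω          = F.fromℕ 1 ⋆ []
  f (ϑ a)      = zero ⋆ ((F.fromℕ 1 ⋆ (f a ∷ [])) ∷ [])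
  f ⟨ [] ⟩     = zero ⋆ []
  f ⟨ a ∷ as ⟩ = (if does (≺Ω? a) then zero else F.fromℕ 1) ⋆ (f a ∷ fs as)

  fs : List Tm → List T2
  fs []       = []
  fs (a ∷ as) = f a ∷ fs as

isOne : Fin 2 → Bool
isOne zero    = false
isOne (suc _) = true

someRootOne : List T2 → Bool
someRootOne []       = false
someRootOne (t ∷ ts) = isOne (r t) ∨ someRootOne ts

mutual
  Ebar : T2 → List T2
  Ebar (zero ⋆ ts) = if someRootOne ts then (zero ⋆ ts) ∷ [] else Ebars ts
  Ebar (suc n ⋆ ts) = Ebars ts

  Ebars : List T2 → List T2
  Ebars []       = []
  Ebars (t ∷ ts) = Ebar t ++ Ebars ts

-- (a) Ē stops exactly at the images f (ϑ β) = 0 ⋆ [1 ⋆ _] of the ϑ-subterms and looks through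
-- every other node of f α.  The one delicate node is f ⟨α₀, …⟩ with α₀ ≺ Ω: its root is 0, but
-- every entry of the descending tuple is then ≺ Ω, so no child has root 1 and Ē does not stop.
-- (b) Ē t only collects 0-rooted subtrees, and 0 ≤ n lets ⊴ descend into any child of n ⋆ _.
-- (c) A 0-rooted node with a 1-rooted child can only be ⊴-matched against a node of the same
-- shape, which is its own Ē, or else lies below a child, where we recurse.
module Submission where

open import Defs
open import Data.List.Relation.Unary.Any using (Any)
open import Data.Product using (_×_)
open import Function.Bundles using (_⇔_)

open import Data.Bool using (true; false)
open import Data.Bool.Properties using (∨-zeroʳ)
open import Data.Fin using (Fin; zero; suc; cast)
import Data.Fin as F
open import Data.Fin.Properties using (cast-involutive; ≤-refl)
open import Data.Nat as ℕ using (z≤n)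
open import Data.List using (List; []; _∷_; _++_; map; length; lookup)
open import Data.List.Properties using (map-++)
open import Data.List.Relation.Unary.All using (All; []; _∷_)
open import Data.List.Relation.Unary.Any using (here; there; index)
open import Data.List.Relation.Unary.Any.Properties using (++⁻; ++⁺ˡ; ++⁺ʳ; map⁺; map⁻; lookup-index)
open import Data.List.Membership.Propositional using (lose)
open import Data.List.Membership.Propositional.Properties using (∈-lookup)
open import Data.List.Relation.Binary.Pointwise as Pointwise using (Pointwise; []; _∷_; Pointwise-length)
open import Data.List.Relation.Binary.Permutation.Propositional using (_↭_; ↭⇒↭ₛ)
import Data.List.Relation.Binary.Permutation.Setoid as Perm
import Data.List.Relation.Binary.Permutation.Setoid.Properties as PermProperties
open import Data.Product using (_,_)
open import Data.Sum using (inj₁; inj₂)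
open import Function.Bundles using (Injection; _↣_; mk↣; mk⇔)
open import Function.Construct.Composition using (_↣-∘_)
open import Function.Definitions using (Injective)
open import Function.Properties.Inverse using (↔⇒↣)
open import Relation.Nullary using (yes; no)
open import Relation.Nullary.Negation using (contradiction)
open import Relation.Binary.PropositionalEquality
  using (_≡_; refl; sym; trans; cong; cong₂; setoid; module ≡-Reasoning)

Ebar-zero⋆-false : ∀ ts → someRootOne ts ≡ false → Ebar (zero ⋆ ts) ≡ Ebars ts
Ebar-zero⋆-false ts e rewrite e = refl

Ebar-zero⋆-true : ∀ ts → someRootOne ts ≡ true → Ebar (zero ⋆ ts) ≡ (zero ⋆ ts) ∷ []
Ebar-zero⋆-true ts e rewrite e = refl

≺-trans-≺Ω : ∀ {x a} → x ≺ a → a ≺ Ω → x ≺ Ω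
≺-trans-≺Ω (ϑ≺ϑ₁ _ _)                ϑ≺Ω      = ϑ≺Ω
≺-trans-≺Ω (ϑ≺ϑ₂ _)                  ϑ≺Ω      = ϑ≺Ω
≺-trans-≺Ω []≺ϑ                      ϑ≺Ω      = []≺Ω
≺-trans-≺Ω (∷≺ϑ x≺a)                 ϑ≺Ω      = ∷≺Ω (≺-trans-≺Ω x≺a ϑ≺Ω)
≺-trans-≺Ω (⟨⟩≺⟨⟩ ())                []≺Ω
≺-trans-≺Ω (Ω≺⟨⟩ (inj₁ Ω≺b))         (∷≺Ω b≺Ω) with () ← ≺-trans-≺Ω Ω≺b b≺Ω
≺-trans-≺Ω (Ω≺⟨⟩ (inj₂ refl))        (∷≺Ω ())
≺-trans-≺Ω (ϑ≺⟨⟩ _)                  (∷≺Ω _)   = ϑ≺Ω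
≺-trans-≺Ω (⟨⟩≺⟨⟩ lex-[])            (∷≺Ω _)   = []≺Ω
≺-trans-≺Ω (⟨⟩≺⟨⟩ (lex-here x≺b))    (∷≺Ω b≺Ω) = ∷≺Ω (≺-trans-≺Ω x≺b b≺Ω)
≺-trans-≺Ω (⟨⟩≺⟨⟩ (lex-there _))     (∷≺Ω b≺Ω) = ∷≺Ω b≺Ω

Descending⇒All≺Ω : ∀ {a as} → a ≺ Ω → Descending (a ∷ as) → All (_≺ Ω) (a ∷ as)
Descending⇒All≺Ω a≺Ω d[a]                = a≺Ω ∷ []
Descending⇒All≺Ω a≺Ω (d∷ (inj₁ b≺a) d)  = a≺Ω ∷ Descending⇒All≺Ω (≺-trans-≺Ω b≺a a≺Ω) d
Descending⇒All≺Ω a≺Ω (d∷ (inj₂ refl) d) = a≺Ω ∷ Descending⇒All≺Ω a≺Ω d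

r-f-≺Ω : ∀ {x} → x ≺ Ω → r (f x) ≡ zero
r-f-≺Ω ϑ≺Ω  = refl
r-f-≺Ω []≺Ω = refl
r-f-≺Ω (∷≺Ω {a} a≺Ω) with ≺Ω? a
... | yes _   = refl
... | no a⊀Ω = contradiction a≺Ω a⊀Ω

someRootOne-fs-≺Ω : ∀ {xs} → All (_≺ Ω) xs → someRootOne (fs xs) ≡ false
someRootOne-fs-≺Ω []           = refl
someRootOne-fs-≺Ω (x≺Ω ∷ xs≺Ω) rewrite r-f-≺Ω x≺Ω = someRootOne-fs-≺Ω xs≺Ω

mutual
  Ebar-f : ∀ {a} → IsTerm a → Ebar (f a) ≡ map f (E a)
  Ebar-f tΩ                    = refl
  Ebar-f (tϑ _)                = refl
  Ebar-f (t⟨⟩ {[]} _ _ _)      = refl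
  Ebar-f (t⟨⟩ {a ∷ as} ts d _) with ≺Ω? a
  ... | yes a≺Ω = trans (Ebar-zero⋆-false (fs (a ∷ as)) (someRootOne-fs-≺Ω (Descending⇒All≺Ω a≺Ω d)))
                        (Ebars-fs ts)
  ... | no _    = Ebars-fs ts

  Ebars-fs : ∀ {as} → All IsTerm as → Ebars (fs as) ≡ map f (Es as)
  Ebars-fs []                = refl
  Ebars-fs {a ∷ as} (t ∷ ts) = begin
    Ebar (f a) ++ Ebars (fs as)  ≡⟨ cong₂ _++_ (Ebar-f t) (Ebars-fs ts) ⟩
    map f (E a) ++ map f (Es as) ≡⟨ sym (map-++ f (E a) (Es as)) ⟩
    map f (E a ++ Es as)         ∎
    where open ≡-Reasoning

Any-Ebar-f⇔Any-E : (α : Tm) → IsTerm α → (s : T2) →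
                   Any (s ≈T_) (Ebar (f α)) ⇔ Any (λ γ → s ≈T f γ) (E α)
Any-Ebar-f⇔Any-E α tα s rewrite Ebar-f tα = mk⇔ map⁻ map⁺

record IndexEmbedding {A B : Set} (R : A → B → Set) (xs : List A) (ys : List B) : Set where
  field
    positions : Fin (length xs) ↣ Fin (length ys)
    related   : ∀ i → R (lookup xs i) (lookup ys (Injection.to positions i))

open IndexEmbedding

IndexEmbedding-∘ : ∀ {A B C : Set} {R : A → B → Set} {S : B → C → Set} {T : A → C → Set}
                   {xs ys zs} → (∀ {x y z} → R x y → S y z → T x z) →
                   IndexEmbedding R xs ys → IndexEmbedding S ys zs → IndexEmbedding T xs zs
IndexEmbedding-∘ compose e₁ e₂ = record
  { positions = positions e₂ ↣-∘ positions e₁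
  ; related   = λ i → compose (related e₁ i) (related e₂ (Injection.to (positions e₁) i))
  }

↭⇒IndexEmbedding : ∀ {A : Set} {xs ys : List A} → xs ↭ ys → IndexEmbedding _≡_ xs ys
↭⇒IndexEmbedding {A} xs↭ys = record
  { positions = ↔⇒↣ (Perm.onIndices (↭⇒↭ₛ xs↭ys))
  ; related   = PermProperties.onIndices-lookup (setoid A) (↭⇒↭ₛ xs↭ys)
  }

cast-injective : ∀ {m n} .(m≡n : m ≡ n) → Injective _≡_ _≡_ (cast m≡n)
cast-injective m≡n {i} {j} eq = begin
  i                           ≡⟨ sym (cast-involutive (sym m≡n) m≡n i) ⟩
  cast (sym m≡n) (cast m≡n i) ≡⟨ cong (cast (sym m≡n)) eq ⟩
  cast (sym m≡n) (cast m≡n j) ≡⟨ cast-involutive (sym m≡n) m≡n j ⟩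
  j                           ∎
  where open ≡-Reasoning

Pointwise⇒IndexEmbedding : ∀ {A B : Set} {R : A → B → Set} {xs ys} →
                           Pointwise R xs ys → IndexEmbedding R xs ys
Pointwise⇒IndexEmbedding xs∼ys = record
  { positions = mk↣ (cast-injective (Pointwise-length xs∼ys))
  ; related   = Pointwise.lookup⁺ xs∼ys
  }

IndexEmbedding⇒⊴ : ∀ {n σ τ} → IndexEmbedding _⊴_ σ τ → (n ⋆ σ) ⊴ (n ⋆ τ)
IndexEmbedding⇒⊴ e = ⊴-M (Injection.to (positions e)) (Injection.injective (positions e)) (related e)

mutual
  ≈T⇒⊴ : ∀ {s t} → s ≈T t → s ⊴ t
  ≈T⇒⊴ (≈⋆ σ↭ρ ρ≈τ) = IndexEmbedding⇒⊴
    (IndexEmbedding-∘ (λ { refl y⊴z → y⊴z }) (↭⇒IndexEmbedding σ↭ρ)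
                      (Pointwise⇒IndexEmbedding (Pointwise-≈T⇒⊴ ρ≈τ)))

  Pointwise-≈T⇒⊴ : ∀ {ρ τ} → Pointwise _≈T_ ρ τ → Pointwise _⊴_ ρ τ
  Pointwise-≈T⇒⊴ []           = []
  Pointwise-≈T⇒⊴ (s≈t ∷ ρ≈τ) = ≈T⇒⊴ s≈t ∷ Pointwise-≈T⇒⊴ ρ≈τ

mutual
  Ebar-r≡zero : ∀ {s} t → Any (s ≈T_) (Ebar t) → r s ≡ zero
  Ebar-r≡zero (zero ⋆ ts) s∈ with someRootOne ts
  Ebar-r≡zero (zero ⋆ ts) (here (≈⋆ _ _)) | true  = refl
  ...                                      | false = Ebars-r≡zero ts s∈
  Ebar-r≡zero (suc _ ⋆ ts) s∈ = Ebars-r≡zero ts s∈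

  Ebars-r≡zero : ∀ {s} ts → Any (s ≈T_) (Ebars ts) → r s ≡ zero
  Ebars-r≡zero (t ∷ ts) s∈ with ++⁻ (Ebar t) s∈
  ... | inj₁ s∈t  = Ebar-r≡zero t s∈t
  ... | inj₂ s∈ts = Ebars-r≡zero ts s∈ts

zero≤ : ∀ {k} {i n : Fin (ℕ.suc k)} → i ≡ zero → i F.≤ n
zero≤ refl = z≤n

mutual
  Ebar⇒⊴ : (t s : T2) → Any (s ≈T_) (Ebar t) → s ⊴ t
  Ebar⇒⊴ (zero ⋆ ts) s s∈ with someRootOne ts
  Ebar⇒⊴ (zero ⋆ ts) s (here s≈t) | true  = ≈T⇒⊴ s≈t
  ...                              | false = ⊴-sub (zero≤ (Ebars-r≡zero ts s∈)) (Ebars⇒⊴ ts s s∈)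
  Ebar⇒⊴ (suc _ ⋆ ts) s s∈ = ⊴-sub (zero≤ (Ebars-r≡zero ts s∈)) (Ebars⇒⊴ ts s s∈)

  Ebars⇒⊴ : (ts : List T2) (s : T2) → Any (s ≈T_) (Ebars ts) → Any (s ⊴_) ts
  Ebars⇒⊴ (t ∷ ts) s s∈ with ++⁻ (Ebar t) s∈
  ... | inj₁ s∈t  = here (Ebar⇒⊴ t s s∈t)
  ... | inj₂ s∈ts = there (Ebars⇒⊴ ts s s∈ts)

⊴⇒r≤r : ∀ {s t} → s ⊴ t → r s F.≤ r t
⊴⇒r≤r {n ⋆ _} (⊴-M _ _ _) = ≤-refl
⊴⇒r≤r (⊴-sub r≤n _)       = r≤n

RootOne : T2 → Set
RootOne t = r t ≡ suc zero

⊴-RootOne : ∀ {s t} → RootOne s → s ⊴ t → RootOne t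
⊴-RootOne {_ ⋆ _} {zero ⋆ _}  refl s⊴t with () ← ⊴⇒r≤r s⊴t
⊴-RootOne {t = suc zero ⋆ _} _    _   = refl

someRootOne-true : ∀ {ts} → Any RootOne ts → someRootOne ts ≡ true
someRootOne-true {(_ ⋆ _) ∷ _} (here refl)    = refl
someRootOne-true {t ∷ _}       (there one∈ts) rewrite someRootOne-true one∈ts = ∨-zeroʳ (isOne (r t))

Any-RootOne-along : ∀ {σ τ} (g : Fin (length σ) → Fin (length τ)) →
                    (∀ i → lookup σ i ⊴ lookup τ (g i)) → Any RootOne σ → Any RootOne τ
Any-RootOne-along g σ⊴τ one∈σ =
  lose (∈-lookup (g (index one∈σ))) (⊴-RootOne (lookup-index one∈σ) (σ⊴τ (index one∈σ)))

mutual
  ⊴-Ebar : ∀ {σ} t → Any RootOne σ → (zero ⋆ σ) ⊴ t → Any ((zero ⋆ σ) ⊴_) (Ebar t)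
  ⊴-Ebar (zero ⋆ τ) one∈σ s⊴t@(⊴-M g _ σ⊴τ)
    rewrite Ebar-zero⋆-true τ (someRootOne-true {τ} (Any-RootOne-along g σ⊴τ one∈σ)) = here s⊴t
  ⊴-Ebar (zero ⋆ ts) one∈σ (⊴-sub r≤n s⊴ts) with someRootOne ts
  ... | true  = here (⊴-sub r≤n s⊴ts)
  ... | false = ⊴-Ebars ts one∈σ s⊴ts
  ⊴-Ebar (suc _ ⋆ ts) one∈σ (⊴-sub _ s⊴ts) = ⊴-Ebars ts one∈σ s⊴ts

  ⊴-Ebars : ∀ {σ} ts → Any RootOne σ → Any ((zero ⋆ σ) ⊴_) ts → Any ((zero ⋆ σ) ⊴_) (Ebars ts)
  ⊴-Ebars (t ∷ ts) one∈σ (here s⊴t)   = ++⁺ˡ (⊴-Ebar t one∈σ s⊴t)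
  ⊴-Ebars (t ∷ ts) one∈σ (there s⊴ts) = ++⁺ʳ (Ebar t) (⊴-Ebars ts one∈σ s⊴ts)

lemma3p5 : ((α : Tm) → IsTerm α → (s : T2) →
    (Any (s ≈T_) (Ebar (f α)) ⇔ Any (λ γ → s ≈T f γ) (E α)))
    × ((t s : T2) → Any (s ≈T_) (Ebar t) → s ⊴ t)
    × ((σ : Tm) → IsTerm σ → (t : T2) → f (ϑ σ) ⊴ t →
    Any (λ t′ → f (ϑ σ) ⊴ t′) (Ebar t))
lemma3p5 = Any-Ebar-f⇔Any-E , Ebar⇒⊴ , λ σ _ t → ⊴-Ebar t (here refl)
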